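{- For every literal $l\in\mathbb{L}$ and every base $\mathcal{B}$: $\{l\}\vdash_{\mathcal{B}}\bot$ if and only if $\{l\}\vdash_{\mathcal{B}} m$ for all $m\in\mathbb{L}$.
   Context: Let $\mathbb{C}$ be a denumerable set of contents and $\mathbb{L} = \{c^+, c^- : c\in\mathbb{C}\}$ the set of literals; for a literal $l$, $l^\bot$ denotes its dual ($(c^+)^\bot=c^-$, $(c^-)^\bot=c^+$). The symbol $\bot$ is not a literal. An atomic rule has the form $(L_1\Rightarrow l_1),\ldots,(L_n\Rightarrow l_n)\Rightarrow l$ with $n\ge 0$, $l,l_i\in\mathbb{L}$ and $L_i\subseteq\mathbb{L}$ finite; $\Rightarrow l$ denotes the rule with $n=0$. A base is a (possibly infinite) set of atomic rules. Derivability in a base $\mathcal{B}$ is the smallest relation $L\vdash_{\mathcal{B}} l$ between finite sets $L\subseteq\mathbb{L}$ and $l\in\mathbb{L}\cup\{\bot\}$ such that: (REF) if $l\in L$ then $L\vdash_{\mathcal{B}} l$; (APP$_1$) if $(\Rightarrow l)\in\mathcal{B}$ then $L\vdash_{\mathcal{B}} l$ for every $L$; (APP$_2$) if $(L_1\Rightarrow l_1),\ldots,(L_n\Rightarrow l_n)\Rightarrow l\in\mathcal{B}$ and $L\cup L_i\vdash_{\mathcal{B}} l_i$ for $i=1,\ldots,n$, then $L\vdash_{\mathcal{B}} l$; (ABS) if $L\vdash_{\mathcal{B}} m$ and $L\vdash_{\mathcal{B}} m^\bot$ for some $m\in\mathbb{L}$, then $L\vdash_{\mathcal{B}}\bot$;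 (DM) if $L\cup\{m\}\vdash_{\mathcal{B}}\bot$ for $m\in\mathbb{L}$, then $L\vdash_{\mathcal{B}} m^\bot$. -}

module Defs where

open import Data.Nat using (ℕ)
open import Data.List using (List; []; _∷_; _++_)
open import Data.List.Membership.Propositional using (_∈_)
open import Data.Product using (_×_; _,_)

Content : Set
Content = ℕ

data Literal : Set where
  _⁺ : Content → Literal
  _⁻ : Content → Literal

dual : Literal → Literal
dual (c ⁺) = c ⁻
dual (c ⁻) = c ⁺

data Target : Set where
  lit : Literal → Target
  bot : Target

-- Finite sets of literals, represented by lists (only membership is used).
LitSet : Set
LitSet = List Literal

record Rule : Set where
  constructor _⇒_
  field
    premises : List (LitSet × Literal)
    head     : Literal

-- A base: a (possibly infinite) set of atomic rules, as a predicate.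
Base : Set₁
Base = Rule → Set

-- Derivability L ⊢_B t.  L ∪ L' is rendered as list concatenation,
-- L ∪ {m} as m ∷ L.
data _⊢[_]_ (L : LitSet) (B : Base) : Target → Set
data Prems (L : LitSet) (B : Base) : List (LitSet × Literal) → Set

data _⊢[_]_ L B where
  REF  : ∀ {l} → l ∈ L → L ⊢[ B ] lit l
  APP₁ : ∀ {l} → B ([] ⇒ l) → L ⊢[ B ] lit l
  APP₂ : ∀ {ps l} → B (ps ⇒ l) → Prems L B ps → L ⊢[ B ] lit l
  ABS  : ∀ {m} → L ⊢[ B ] lit m → L ⊢[ B ] lit (dual m) → L ⊢[ B ] bot
  DM   : ∀ {m} → (m ∷ L) ⊢[ B ] bot → L ⊢[ B ] lit (dual m)

data Prems L B where
  []  : Prems L B []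
  _∷_ : ∀ {Lᵢ lᵢ ps} → (L ++ Lᵢ) ⊢[ B ] lit lᵢ → Prems L B ps → Prems L B ((Lᵢ , lᵢ) ∷ ps)

{-# OPTIONS --safe #-}
module Submission where

open import Defs
open import Data.List using ([_]; _∷_; _++_)
open import Data.List.Relation.Binary.Subset.Propositional using (_⊆_)
open import Data.List.Relation.Binary.Subset.Propositional.Properties
  using (xs⊆x∷xs; ∷⁺ʳ; ++⁺ˡ)
open import Data.Product using (_×_; _,_)
open import Relation.Binary.PropositionalEquality using (_≡_; refl; subst)

dual-involutive : ∀ m → dual (dual m) ≡ m
dual-involutive (c ⁺) = refl
dual-involutive (c ⁻) = refl

⊢-weaken : ∀ {B L L' t} → L ⊆ L' → L ⊢[ B ] t → L' ⊢[ B ] t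
Prems-weaken : ∀ {B L L' ps} → L ⊆ L' → Prems L B ps → Prems L' B ps
⊢-weaken L⊆L' (REF l∈L)      = REF (L⊆L' l∈L)
⊢-weaken L⊆L' (APP₁ r)       = APP₁ r
⊢-weaken L⊆L' (APP₂ r ds)    = APP₂ r (Prems-weaken L⊆L' ds)
⊢-weaken L⊆L' (ABS d d⊥)     = ABS (⊢-weaken L⊆L' d) (⊢-weaken L⊆L' d⊥)
⊢-weaken L⊆L' (DM {m = m} d) = DM (⊢-weaken (∷⁺ʳ m L⊆L') d)
Prems-weaken L⊆L' []                   = []
Prems-weaken L⊆L' (_∷_ {Lᵢ = Lᵢ} d ds) = ⊢-weaken (++⁺ˡ Lᵢ L⊆L') d ∷ Prems-weaken L⊆L' ds

-- Weaken to L ∪ {m^⊥} and discharge m^⊥ by DM, which yields m^⊥⊥ = m.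
⊢bot⇒⊢lit : ∀ {B L} → L ⊢[ B ] bot → ∀ m → L ⊢[ B ] lit m
⊢bot⇒⊢lit {B} {L} d m =
  subst (λ l → L ⊢[ B ] lit l) (dual-involutive m)
        (DM {m = dual m} (⊢-weaken (xs⊆x∷xs L (dual m)) d))

⊢lit⇒⊢bot : ∀ {B L} → (∀ m → L ⊢[ B ] lit m) → L ⊢[ B ] bot
⊢lit⇒⊢bot ⊢m = ABS {m = 0 ⁺} (⊢m (0 ⁺)) (⊢m (0 ⁻))

mainTheorem5 : (l : Literal) (B : Base) →
    (([ l ] ⊢[ B ] bot → (∀ m → [ l ] ⊢[ B ] lit m))
    × ((∀ m → [ l ] ⊢[ B ] lit m) → [ l ] ⊢[ B ] bot))
mainTheorem5 l B = ⊢bot⇒⊢lit , ⊢lit⇒⊢bot
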